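{- Let $a$ and $c$ be distinct odd primes such that $a^2+a+1$ is prime and $a^2+a+1\mid c^2+c+1$. Then $a^2+a+1<\frac{c}{2}$. -}

module Defs where

open import Data.Nat using (ℕ; _+_; _*_)

q : ℕ → ℕ
q x = x * x + x + 1

module Submission where

-- Write p = q a.  Since q is strictly increasing, p ∣ q c forces a < c, so
-- c = a + d with d > 0 and  q c = q a + d · (a + c + 1).  As p is prime it
-- divides d or a + c + 1, and parity finishes both cases:
--   * a, c odd make d even while p = q a is always odd, so the quotient d / p
--     is even and nonzero, whence d ≥ 2p and c = a + d > 2p;
--   * a + c + 1 is odd, so (a + c + 1) / p is odd; it cannot be 1, since then
--     c = a² would be the square of a prime, so it is at least 3, and
--     3p ≤ a + c + 1 gives c ≥ 2p + a² > 2p.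

open import Defs
open import Data.Nat
  using (ℕ; zero; suc; _+_; _*_; _<_; _≤_; parity;
         >-nonZero; >-nonZero⁻¹; nonTrivial⇒n>1)
open import Data.Nat.Properties
open import Data.Nat.Divisibility
  using (_∣_; divides; ∣-refl; ∣⇒≤; >⇒∤; m∣m*n; ∣m+n∣m⇒∣n)
open import Data.Nat.Primality
  using (Prime; euclidsLemma; composite; composite⇒¬prime;
         prime⇒nonZero; prime⇒nonTrivial)
open import Data.Nat.Tactic.RingSolver using (solve-∀)
open import Data.Parity.Base using (0ℙ; 1ℙ)
open import Data.Parity.Properties using (+-homo-+; *-homo-*)
open import Data.Product using (_,_)
open import Data.Sum using (_⊎_; inj₁; inj₂)
open import Data.Empty using (⊥-elim)
open import Relation.Nullary using (¬_; contradiction)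
open import Relation.Binary.Definitions using (tri<; tri≈; tri>)
open import Relation.Binary.PropositionalEquality

parity≡0ℙ⇒2∣ : ∀ n → parity n ≡ 0ℙ → 2 ∣ n
parity≡0ℙ⇒2∣ zero          _    = divides 0 refl
parity≡0ℙ⇒2∣ (suc zero)    ()
parity≡0ℙ⇒2∣ (suc (suc n)) even with parity≡0ℙ⇒2∣ n even
... | divides k n≡k*2 = divides (suc k) (cong (λ m → suc (suc m)) n≡k*2)

¬2∣⇒parity≡1ℙ : ∀ {n} → ¬ 2 ∣ n → parity n ≡ 1ℙ
¬2∣⇒parity≡1ℙ {n} odd with parity n in eq
... | 0ℙ = ⊥-elim (odd (parity≡0ℙ⇒2∣ n eq))
... | 1ℙ = refl

-- q x is odd for every x, because x² + x = x (x + 1) is even.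
parity-q : ∀ x → parity (q x) ≡ 1ℙ
parity-q x
  rewrite +-homo-+ (x * x + x) 1 | +-homo-+ (x * x) x | *-homo-* x x
  with parity x
... | 0ℙ = refl
... | 1ℙ = refl

parity-odd-sum : ∀ a c → parity a ≡ 1ℙ → parity c ≡ 1ℙ →
                 parity (a + c + 1) ≡ 1ℙ
parity-odd-sum a c odd-a odd-c
  rewrite +-homo-+ (a + c) 1 | +-homo-+ a c | odd-a | odd-c = refl

parity-odd-gap : ∀ a d → parity a ≡ 1ℙ → parity (a + d) ≡ 1ℙ →
                 parity d ≡ 0ℙ
parity-odd-gap a d odd-a odd-ad
  rewrite +-homo-+ a d | odd-a with parity d
... | 0ℙ = refl
... | 1ℙ = contradiction odd-ad λ ()

parity-*-odd : ∀ k {p} → parity p ≡ 1ℙ → parity (k * p) ≡ parity k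
parity-*-odd k {p} odd-p rewrite *-homo-* k p | odd-p with parity k
... | 0ℙ = refl
... | 1ℙ = refl

-- An even multiple n of an odd number p is a multiple of 2p; so if n ≠ 0,
-- then n ≥ 2p.
even-multiple-bound : ∀ {p n} → parity p ≡ 1ℙ → parity n ≡ 0ℙ → p ∣ n →
                      0 < n → 2 * p ≤ n
even-multiple-bound {p} odd-p even-n (divides k refl) n>0
  with parity≡0ℙ⇒2∣ k (trans (sym (parity-*-odd k odd-p)) even-n)
... | divides j k≡j*2 = ∣⇒≤ {{>-nonZero n>0}} 2p∣n
  where
  2p∣n : 2 * p ∣ k * p
  2p∣n = divides j (trans (cong (_* p) k≡j*2) (*-assoc j 2 p))

q-shift : ∀ x d → q (x + d) ≡ q x + d * (x + (x + d) + 1)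
q-shift = expanded
  where
  expanded : ∀ x d → (x + d) * (x + d) + (x + d) + 1
                   ≡ x * x + x + 1 + d * (x + (x + d) + 1)
  expanded = solve-∀

q-mono-< : ∀ {x y} → x < y → q x < q y
q-mono-< x<y = +-monoˡ-< 1 (+-mono-≤-< (*-mono-≤ (<⇒≤ x<y) (<⇒≤ x<y)) x<y)

q-mono-∤ : ∀ {x y} → x < y → ¬ q y ∣ q x
q-mono-∤ {x} x<y = >⇒∤ {{>-nonZero (m≤n+m 1 (x * x + x))}} (q-mono-< x<y)

prime∣q-shift : ∀ {p} x d → Prime p → p ∣ q x → p ∣ q (x + d) →
                p ∣ d ⊎ p ∣ x + (x + d) + 1
prime∣q-shift {p} x d p-prime p∣qx p∣qx+d =
  euclidsLemma d (x + (x + d) + 1) p-prime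
    (∣m+n∣m⇒∣n (subst (p ∣_) (q-shift x d) p∣qx+d) p∣qx)

sum≡q⇒square : ∀ x y → x + y + 1 ≡ q x → y ≡ x * x
sum≡q⇒square x y eq = +-cancelʳ-≡ (x + 1) y (x * x) (begin
  y + (x + 1)      ≡⟨ rearrange-left x y ⟩
  x + y + 1        ≡⟨ eq ⟩
  q x              ≡⟨ rearrange-right x ⟩
  x * x + (x + 1)  ∎)
  where
  open ≡-Reasoning
  rearrange-left : ∀ x y → y + (x + 1) ≡ x + y + 1
  rearrange-left = solve-∀
  rearrange-right : ∀ x → x * x + x + 1 ≡ x * x + (x + 1)
  rearrange-right = solve-∀

triple-q-bound : ∀ x y → 0 < x → 3 * q x ≤ x + y + 1 → 2 * q x < y
triple-q-bound x y x>0 le = begin-strict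
  2 * q x          <⟨ m<m+n (2 * q x) (*-mono-≤ x>0 x>0) ⟩
  2 * q x + x * x  ≤⟨ +-cancelʳ-≤ (x + 1) _ _ le′ ⟩
  y                ∎
  where
  open ≤-Reasoning
  split-triple : ∀ x → 3 * (x * x + x + 1)
                     ≡ (2 * (x * x + x + 1) + x * x) + (x + 1)
  split-triple = solve-∀
  split-sum : ∀ x y → x + y + 1 ≡ y + (x + 1)
  split-sum = solve-∀
  le′ : (2 * q x + x * x) + (x + 1) ≤ y + (x + 1)
  le′ = subst₂ _≤_ (split-triple x) (split-sum x y) le

-- The square of a prime is not prime: the prime itself is a proper divisor.
square-not-prime : ∀ {a} → Prime a → ¬ Prime (a * a)
square-not-prime {a} a-prime =
  composite⇒¬prime (composite (m<m*n a a (nonTrivial⇒n>1 a)) (m∣m*n a))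
  where
  instance
    _ = prime⇒nonTrivial a-prime
    _ = prime⇒nonZero a-prime

prime⇒positive : ∀ {p} → Prime p → 0 < p
prime⇒positive {p} p-prime = >-nonZero⁻¹ p {{prime⇒nonZero p-prime}}

-- Case q a ∣ c − a: the gap d = c − a is an even positive multiple of the
-- odd number q a, so c = a + d > d ≥ 2 q a.
gap-factor-bound : ∀ a d → 0 < a → 0 < d →
                   parity a ≡ 1ℙ → parity (a + d) ≡ 1ℙ → q a ∣ d →
                   2 * q a < a + d
gap-factor-bound a d a>0 d>0 odd-a odd-ad qa∣d = ≤-<-trans
  (even-multiple-bound (parity-q a) (parity-odd-gap a d odd-a odd-ad) qa∣d d>0)
  (m<n+m d a>0)

-- Case q a ∣ a + c + 1 = k · q a: k = 0 is impossible as the sum is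
-- positive, k = 1 would make c = a² prime, k = 2 contradicts the oddness of
-- a + c + 1, and k ≥ 3 gives the bound.
sum-factor-bound : ∀ {a c} → Prime a → Prime c →
                   parity a ≡ 1ℙ → parity c ≡ 1ℙ → q a ∣ a + c + 1 →
                   2 * q a < c
sum-factor-bound {a} {c} _ _ _ _ (divides zero sum≡0) =
  contradiction (m+n≡0⇒n≡0 (a + c) sum≡0) λ ()
sum-factor-bound {a} {c} a-prime c-prime _ _ (divides 1 sum≡qa) =
  contradiction (subst Prime c≡a² c-prime) (square-not-prime a-prime)
  where
  c≡a² : c ≡ a * a
  c≡a² = sum≡q⇒square a c (trans sum≡qa (+-identityʳ (q a)))
sum-factor-bound {a} {c} _ _ odd-a odd-c (divides 2 sum≡2qa) =
  contradiction 1ℙ≡0ℙ λ ()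
  where
  1ℙ≡0ℙ : 1ℙ ≡ 0ℙ
  1ℙ≡0ℙ = begin
    1ℙ                   ≡⟨ parity-odd-sum a c odd-a odd-c ⟨
    parity (a + c + 1)   ≡⟨ cong parity sum≡2qa ⟩
    parity (2 * q a)     ≡⟨ *-homo-* 2 (q a) ⟩
    0ℙ                   ∎
    where open ≡-Reasoning
sum-factor-bound {a} {c} a-prime _ _ _ (divides (suc (suc (suc k))) sum≡kqa) =
  triple-q-bound a c (prime⇒positive a-prime)
    (subst (3 * q a ≤_) (sym sum≡kqa) (*-monoˡ-≤ (q a) (m≤m+n 3 k)))

-- The theorem for a < c: write c = a + d and split on which factor of
-- q c − q a = d · (a + c + 1) the prime q a divides.
larger-partner-bound : ∀ {a c} → Prime a → Prime c →
                       parity a ≡ 1ℙ → parity c ≡ 1ℙ → a < c →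
                       Prime (q a) → q a ∣ q c → 2 * q a < c
larger-partner-bound {a} a-prime c-prime odd-a odd-c a<c qa-prime qa∣qc
  with m≤n⇒∃[o]m+o≡n (<⇒≤ a<c)
... | d , refl with prime∣q-shift a d qa-prime ∣-refl qa∣qc
...   | inj₁ qa∣d =
        gap-factor-bound a d (prime⇒positive a-prime) d>0 odd-a odd-c qa∣d
  where
  d>0 : 0 < d
  d>0 = +-cancelˡ-< a 0 d (subst (_< a + d) (sym (+-identityʳ a)) a<c)
...   | inj₂ qa∣sum = sum-factor-bound a-prime c-prime odd-a odd-c qa∣sum

lemma33 : (a c : ℕ) → Prime a → Prime c → ¬ (2 ∣ a) → ¬ (2 ∣ c) → a ≢ c →
          Prime (q a) → q a ∣ q c → 2 * q a < c
lemma33 a c a-prime c-prime 2∤a 2∤c a≢c qa-prime qa∣qc with <-cmp a c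
... | tri< a<c _ _ = larger-partner-bound a-prime c-prime
                       (¬2∣⇒parity≡1ℙ 2∤a) (¬2∣⇒parity≡1ℙ 2∤c) a<c qa-prime qa∣qc
... | tri≈ _ a≡c _ = contradiction a≡c a≢c
... | tri> _ _ c<a = contradiction qa∣qc (q-mono-∤ c<a)
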